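{- Let $S(G,\sigma)$ be a sandpile instance where $G$ is the complete graph on $n$ vertices. Then $S$ terminates if and only if the total number of firings performed (along a sequence of legal firings starting from $\sigma$) is at most $n-2$.
   Context: Sandpile without sinks: $\sigma\in\mathbb{N}^{V(G)}$ gives chip counts; a vertex $v$ is full if $\sigma_v\ge\deg(v)$ (here $\deg(v)=n-1$); a legal firing of a full vertex $v$ decreases $\sigma_v$ by $\deg(v)$ and adds one chip to each neighbor; a configuration is terminal if no vertex is full; the instance terminates if some finite sequence of legal firings reaches a terminal configuration, otherwise it is recurrent. -}

module Defs where

open import Data.Nat using (ℕ; _+_; _∸_; _≤_; _<_; suc)
open import Data.Fin using (Fin; _≟_)
open import Data.List using (List; []; _∷_; length)
open import Data.Product using (Σ; _×_; ∃; ∃-syntax)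
open import Relation.Nullary using (yes; no)

-- Sandpile (no sink) on the complete graph K_n with vertex set Fin n.
-- Every vertex has degree n - 1 and is adjacent to every other vertex.

Config : ℕ → Set
Config n = Fin n → ℕ

deg : ℕ → ℕ
deg n = n ∸ 1

Full : ∀ {n} → Config n → Fin n → Set
Full {n} σ v = deg n ≤ σ v

fire : ∀ {n} → Config n → Fin n → Config n
fire {n} σ v w with w ≟ v
... | yes _ = σ v ∸ deg n
... | no  _ = suc (σ w)

data Legal {n : ℕ} : Config n → List (Fin n) → Config n → Set where
  done : ∀ {σ} → Legal σ [] σ
  step : ∀ {σ τ v vs} → Full σ v → Legal (fire σ v) vs τ → Legal σ (v ∷ vs) τ

Terminal : ∀ {n} → Config n → Set
Terminal {n} σ = ∀ v → σ v < deg n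

Terminates : ∀ {n} → Config n → Set
Terminates σ = ∃[ τ ] ∃[ vs ] (Legal σ vs τ × Terminal τ)

{-# OPTIONS --safe #-}
-- On K_(k+1) call a budget b : Fin (k+1) → ℕ stabilizing for ρ if firing every vertex w exactly
-- b w times would leave a terminal configuration. A full vertex always has positive budget, and
-- firing it leaves a stabilizing budget for the new configuration with that entry lowered by one;
-- so every legal sequence from ρ has length at most sum b (a least action principle). Reading a
-- terminating sequence backwards yields a stabilizing budget. Adding the same constant to every
-- entry does not change whether a budget stabilizes, so we may subtract its minimum, and at a
-- vertex with budget 0 the condition forces sum b < k. Conversely, if the instance does not
-- terminate, greedily firing full vertices gives a legal sequence of length k + 1.
module Submission where

open import Defs
open import Data.Nat using (ℕ; zero; suc; _+_; _*_; _∸_; _≤_; _<_; z≤n; s≤s; pred; _<?_)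
open import Data.Nat.Properties hiding (_≟_)
open import Data.Fin using (Fin; zero; punchIn; _≟_)
open import Data.Fin.Properties using (punchInᵢ≢i; all?; ¬∀⟶∃¬)
open import Data.List using (List; []; _∷_; length; allFin)
open import Data.List.Extrema ≤-totalOrder using (argmin; f[argmin]≤f[xs])
open import Data.List.Membership.Propositional.Properties using (∈-allFin)
import Data.List.Relation.Unary.All as All
open import Data.Vec.Functional using (updateAt; removeAt; tail)
open import Data.Vec.Functional.Properties
  using (updateAt-updates; updateAt-minimal; updateAt-updateAt-local; updateAt-id)
open import Algebra.Properties.CommutativeMonoid.Sum +-0-commutativeMonoid
  using (sum; sum-cong-≗; sum-remove; sum-replicate-zero)
open import Algebra.Properties.CommutativeSemigroup +-commutativeSemigroup
  using (interchange; x∙yz≈y∙xz)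
open import Data.Product using (_×_; _,_; proj₂; ∃-syntax)
open import Data.Sum using (_⊎_; inj₁; inj₂)
open import Data.Empty using (⊥-elim)
open import Function using (_∘_; _⇔_; mk⇔; Equivalence)
open import Relation.Nullary using (yes; no)
open import Relation.Binary.PropositionalEquality
  using (_≡_; _≗_; refl; sym; trans; cong; cong₂; subst; subst₂; module ≡-Reasoning)

open Equivalence using (to; from)

<-offset : ∀ d {a b a′ b′} → a′ ≡ d + a → b′ ≡ d + b → (a < b) ⇔ (a′ < b′)
<-offset d refl refl = mk⇔ (+-monoʳ-< d) (+-cancelˡ-< d _ _)

sum-updateAt-suc : ∀ {k} (b : Fin (suc k) → ℕ) v → sum (updateAt b v suc) ≡ suc (sum b)
sum-updateAt-suc b v = begin
  sum (updateAt b v suc)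
    ≡⟨ sum-remove (updateAt b v suc) ⟩
  updateAt b v suc v + sum (removeAt (updateAt b v suc) v)
    ≡⟨ cong₂ _+_ (updateAt-updates v b) (sum-cong-≗ untouched) ⟩
  suc (b v) + sum (removeAt b v)
    ≡⟨ cong suc (sum-remove b) ⟨
  suc (sum b)
    ∎
  where
  open ≡-Reasoning
  untouched : ∀ j → updateAt b v suc (punchIn v j) ≡ b (punchIn v j)
  untouched j = updateAt-minimal (punchIn v j) v b (punchInᵢ≢i v j)

sum-shift : ∀ {n} c (b : Fin n → ℕ) → sum (λ w → c + b w) ≡ n * c + sum b
sum-shift {zero}  c b = refl
sum-shift {suc n} c b = trans (cong (c + b zero +_) (sum-shift c (tail b)))
                              (interchange c (b zero) (n * c) _)

-- Firing v adds a chip to every vertex and removes suc k from v, so firing each w exactly b w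
-- times gives w ↦ ρ w + sum b − suc k * b w; its terminality is stated without subtraction.
StabilizesAt : ∀ {k} → Config (suc k) → (Fin (suc k) → ℕ) → Fin (suc k) → Set
StabilizesAt {k} ρ b w = ρ w + sum b < k + suc k * b w

Stabilizes : ∀ {k} → Config (suc k) → (Fin (suc k) → ℕ) → Set
Stabilizes ρ b = ∀ w → StabilizesAt ρ b w

module _ {k : ℕ} {ρ : Config (suc k)} where

  stabilizesAt-unfired : ∀ {b w} → b w ≡ 0 → StabilizesAt ρ b w ⇔ ρ w + sum b < k
  stabilizesAt-unfired {b} {w} bw≡0 = <-offset 0 refl (sym k+suc[k]*0≡k)
    where
    k+suc[k]*0≡k : k + suc k * b w ≡ k
    k+suc[k]*0≡k = trans (cong (λ x → k + suc k * x) bw≡0)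
                         (trans (cong (k +_) (*-zeroʳ (suc k))) (+-identityʳ k))

  stabilizes-resp-≗ : ∀ {b b′} → b ≗ b′ → Stabilizes ρ b → Stabilizes ρ b′
  stabilizes-resp-≗ b≗b′ st w =
    subst₂ _<_ (cong (ρ w +_) (sum-cong-≗ b≗b′)) (cong (λ x → k + suc k * x) (b≗b′ w)) (st w)

  stabilizes-unshift : ∀ c {b} → Stabilizes ρ (λ w → c + b w) → Stabilizes ρ b
  stabilizes-unshift c {b} st w = from (<-offset (suc k * c) loads capacities) (st w)
    where
    loads : ρ w + sum (λ u → c + b u) ≡ suc k * c + (ρ w + sum b)
    loads = trans (cong (ρ w +_) (sum-shift c b)) (x∙yz≈y∙xz (ρ w) (suc k * c) (sum b))
    capacities : k + suc k * (c + b w) ≡ suc k * c + (k + suc k * b w)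
    capacities = trans (cong (k +_) (*-distribˡ-+ (suc k) c (b w))) (x∙yz≈y∙xz k (suc k * c) (suc k * b w))

  budget-positive-at-full : ∀ {b v} → Stabilizes ρ b → Full ρ v → 0 < b v
  budget-positive-at-full {b} {v} st full with b v in bv
  ... | suc _ = s≤s z≤n
  ... | zero  = ⊥-elim (<⇒≱ unfired (≤-trans full (m≤m+n (ρ v) (sum b))))
    where
    unfired : ρ v + sum b < k
    unfired = to (stabilizesAt-unfired {b} {v} bv) (st v)

  fire-shifts-budget : ∀ {v} → Full ρ v → ∀ b w →
                       StabilizesAt (fire ρ v) b w ⇔ StabilizesAt ρ (updateAt b v suc) w
  fire-shifts-budget {v} full b w with w ≟ v
  ... | yes refl = <-offset (suc k) loads capacities
    where
    open ≡-Reasoning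
    loads : ρ v + sum (updateAt b v suc) ≡ suc k + ((ρ v ∸ k) + sum b)
    loads = begin
      ρ v + sum (updateAt b v suc)  ≡⟨ cong (ρ v +_) (sum-updateAt-suc b v) ⟩
      ρ v + suc (sum b)             ≡⟨ +-suc (ρ v) (sum b) ⟩
      suc (ρ v + sum b)             ≡⟨ cong (λ x → suc (x + sum b)) (m+[n∸m]≡n full) ⟨
      suc (k + (ρ v ∸ k) + sum b)   ≡⟨ cong suc (+-assoc k (ρ v ∸ k) (sum b)) ⟩
      suc k + ((ρ v ∸ k) + sum b)   ∎
    capacities : k + suc k * updateAt b v suc v ≡ suc k + (k + suc k * b v)
    capacities = begin
      k + suc k * updateAt b v suc v  ≡⟨ cong (λ x → k + suc k * x) (updateAt-updates v b) ⟩
      k + suc k * suc (b v)           ≡⟨ cong (k +_) (*-suc (suc k) (b v)) ⟩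
      k + (suc k + suc k * b v)       ≡⟨ x∙yz≈y∙xz k (suc k) (suc k * b v) ⟩
      suc k + (k + suc k * b v)       ∎
  ... | no w≢v = <-offset 0 loads capacities
    where
    loads : ρ w + sum (updateAt b v suc) ≡ suc (ρ w) + sum b
    loads = trans (cong (ρ w +_) (sum-updateAt-suc b v)) (+-suc (ρ w) (sum b))
    capacities : k + suc k * updateAt b v suc w ≡ k + suc k * b w
    capacities = cong (λ x → k + suc k * x) (updateAt-minimal w v b w≢v)

  small-stabilizing-budget : ∀ {b} → Stabilizes ρ b → ∃[ b′ ] (Stabilizes ρ b′ × sum b′ < k)
  small-stabilizing-budget {b} st = b′ , st′ , ≤-<-trans (m≤n+m (sum b′) (ρ u)) unfired-at-u
    where
    u : Fin (suc k)
    u = argmin b zero (allFin (suc k))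
    u-minimal : ∀ w → b u ≤ b w
    u-minimal w = All.lookup (f[argmin]≤f[xs] {f = b} zero (allFin (suc k))) (∈-allFin w)
    b′ : Fin (suc k) → ℕ
    b′ w = b w ∸ b u
    st′ : Stabilizes ρ b′
    st′ = stabilizes-unshift (b u) (stabilizes-resp-≗ (λ w → sym (m+[n∸m]≡n (u-minimal w))) st)
    unfired-at-u : ρ u + sum b′ < k
    unfired-at-u = to (stabilizesAt-unfired {b′} {u} (n∸n≡0 (b u))) (st′ u)

  terminal-stabilizes : Terminal ρ → Stabilizes ρ (λ _ → 0)
  terminal-stabilizes terminal w =
    from (stabilizesAt-unfired refl) (subst (_< k) (sym no-chips-added) (terminal w))
    where
    no-chips-added : ρ w + sum {suc k} (λ _ → 0) ≡ ρ w
    no-chips-added = trans (cong (ρ w +_) (sum-replicate-zero (suc k))) (+-identityʳ (ρ w))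

legal-terminal-stabilizes : ∀ {k} {σ τ : Config (suc k)} {vs} → Legal σ vs τ → Terminal τ →
                            ∃[ b ] Stabilizes σ b
legal-terminal-stabilizes done terminal = _ , terminal-stabilizes terminal
legal-terminal-stabilizes (step {v = v} full legal) terminal with legal-terminal-stabilizes legal terminal
... | b , st = updateAt b v suc , λ w → to (fire-shifts-budget full b w) (st w)

legal-length-≤-budget : ∀ {k} {ρ τ : Config (suc k)} {vs} {b : Fin (suc k) → ℕ} → Stabilizes ρ b → Legal ρ vs τ →
                        length vs ≤ sum b
legal-length-≤-budget st done = z≤n
legal-length-≤-budget {k} {ρ} {b = b} st (step {v = v} {vs = vs} full legal) = begin
  suc (length vs)          ≤⟨ s≤s (legal-length-≤-budget st′ legal) ⟩
  suc (sum b′)             ≡⟨ sum-updateAt-suc b′ v ⟨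
  sum (updateAt b′ v suc)  ≡⟨ sum-cong-≗ restored ⟩
  sum b                    ∎
  where
  open ≤-Reasoning
  b′ : Fin (suc k) → ℕ
  b′ = updateAt b v pred
  restored : updateAt b′ v suc ≗ b
  restored w = trans (updateAt-updateAt-local v b (m+[n∸m]≡n positive) w) (updateAt-id v b w)
    where
    positive : 0 < b v
    positive = budget-positive-at-full {ρ = ρ} st full
  st′ : Stabilizes (fire ρ v) b′
  st′ w = from (fire-shifts-budget {ρ = ρ} full b′ w)
               (stabilizes-resp-≗ {ρ = ρ} (sym ∘ restored) st w)

terminates-or-fires : ∀ {n} m (ρ : Config n) →
                      Terminates ρ ⊎ ∃[ vs ] ∃[ τ ] (Legal ρ vs τ × length vs ≡ m)
terminates-or-fires zero ρ = inj₂ ([] , ρ , done , refl)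
terminates-or-fires {n} (suc m) ρ with all? (λ w → ρ w <? deg n)
... | yes terminal = inj₁ (ρ , [] , done , terminal)
... | no ¬terminal with ¬∀⟶∃¬ n _ (λ w → ρ w <? deg n) ¬terminal
... | v , ¬v<deg with terminates-or-fires m (fire ρ v)
...   | inj₁ (τ , vs , legal , terminal) = inj₁ (τ , v ∷ vs , step (≮⇒≥ ¬v<deg) legal , terminal)
...   | inj₂ (vs , τ , legal , len)      = inj₂ (v ∷ vs , τ , step (≮⇒≥ ¬v<deg) legal , cong suc len)

lemma6p8 : (n : ℕ) (σ : Config n) →
           (Terminates σ → ∀ (vs : List (Fin n)) (τ : Config n) → Legal σ vs τ → length vs ≤ n ∸ 2)
           × ((∀ (vs : List (Fin n)) (τ : Config n) → Legal σ vs τ → length vs ≤ n ∸ 2) → Terminates σ)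
lemma6p8 zero σ = (λ { _ [] _ _ → z≤n }) , (λ _ → σ , [] , done , λ ())
lemma6p8 (suc k) σ = short-if-terminates , terminates-if-short
  where
  short-if-terminates : Terminates σ → ∀ vs τ → Legal σ vs τ → length vs ≤ k ∸ 1
  short-if-terminates (_ , _ , legal₀ , terminal) vs τ legal =
    let _ , st , small =
          small-stabilizing-budget {ρ = σ} (proj₂ (legal-terminal-stabilizes legal₀ terminal))
    in ≤-trans (legal-length-≤-budget st legal) (<⇒≤pred small)
  terminates-if-short : (∀ vs τ → Legal σ vs τ → length vs ≤ k ∸ 1) → Terminates σ
  terminates-if-short short with terminates-or-fires (suc k) σ
  ... | inj₁ terminates            = terminates
  ... | inj₂ (vs , τ , legal , len) =
    ⊥-elim (1+n≰n (≤-trans (subst (_≤ k ∸ 1) len (short vs τ legal)) (m∸n≤m k 1)))
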